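{- Let $n\ge 2$ and let $A:=A_1A_2\cdots A_p$, where each $A_j\in\mathbb{R}^{n\times n}$ is either an elementary bidiagonal matrix $L_i(q)$ or $U_i(q)$ (for some $i\in\{2,\dots,n\}$ and $q\in\mathbb{R}$) or a diagonal matrix with positive diagonal entries. Pick $c\in\{1,\dots,n-1\}$, and let $\alpha:=\{n-c+1,\dots,n\}$, $\beta:=\{1,\dots,c\}$ (so that $A(\alpha|\beta)$ is a lower-left corner minor of $A$). Let $w=w(A,c)$ be the least positive integer $w$ (with $w=+\infty$ if none exists) such that the planar network associated with $A^w$ contains a family of pairwise vertex-disjoint paths, one from source $x$ to sink $x-n+c$ for every $x\in\alpha$. Then $w(A,c)$ does not change if every factor $A_j$ of the form $U_i(q)$ is replaced by an arbitrary diagonal matrix with positive diagonal entries.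
   Context: For $i\in\{2,\dots,n\}$ and $q\in\mathbb{R}$, $L_i(q):=I+qE_{i,i-1}$ and $U_i(q):=L_i(q)^T$, where $E_{i,j}$ is the $n\times n$ matrix whose only nonzero entry is a $1$ in position $(i,j)$; these are the elementary bidiagonal (EB) matrices. For a (sub)matrix minor, $A(\alpha|\beta)$ denotes the determinant of the submatrix with rows indexed by $\alpha$ and columns indexed by $\beta$. Planar network of a product $A=A_1\cdots A_p$ of EB and positive diagonal matrices: a directed graph with vertex layers $0,1,\dots,p$, each layer having $n$ vertices labelled $1,\dots,n$ (drawn from bottom to top); for each $j$ there is a horizontal edge from vertex $i$ of layer $j-1$ to vertex $i$ of layer $j$ for every $i$; additionally, if $A_j=L_i(q)$ there is a (downward) edge from vertex $i$ of layer $j-1$ to vertex $i-1$ of layer $j$ (weight $q$), and if $A_j=U_i(q)$ there is an (upward) edge from vertex $i-1$ of layer $j-1$ to vertex $i$ of layer $j$ (weight $q$); a positive diagonal factor contributes only horizontal edges (weighted by its diagonal entries). Sources are the vertices of layer $0$, sinks those of layer $p$. The planar network of $A^w$ is obtained by concatenating $w$ copies of the network of $A$ (i.e. the network of the product of $w$ copies of the factor sequence $A_1,\dots,A_p$). -}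

module Defs where

open import Data.Nat using (ℕ; zero; suc; _+_; _*_; _∸_; _≤_; _<_)
open import Data.List using (List; []; _∷_; _++_; map; length)
open import Data.Product using (_×_; Σ; ∃)
open import Data.Sum using (_⊎_)
open import Data.Empty using (⊥)
open import Data.Maybe using (Maybe; just; nothing)
open import Relation.Binary.PropositionalEquality using (_≡_; _≢_)
open import Relation.Nullary using (¬_)

-- Vertices of each layer are labelled 1,…,n (1-based, as in the paper).
-- A factor of the product A = A₁⋯A_p, recorded by the edges it contributes
-- to the planar network (the weights q / diagonal entries play no role in
-- the existence of vertex-disjoint path families, hence in w(A,c)).
--   L i : L_i(q), 2 ≤ i ≤ n : edge  i (layer j-1) → i-1 (layer j)
--   U i : U_i(q), 2 ≤ i ≤ n : edge  i-1 (layer j-1) → i (layer j)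
--   D   : positive diagonal matrix : horizontal edges only
data Factor (n : ℕ) : Set where
  L : (i : ℕ) → 2 ≤ i → i ≤ n → Factor n
  U : (i : ℕ) → 2 ≤ i → i ≤ n → Factor n
  D : Factor n

Edge : {n : ℕ} → Factor n → ℕ → ℕ → Set
Edge (L i _ _) a b = (a ≡ i) × (b ≡ i ∸ 1)
Edge (U i _ _) a b = (a ≡ i ∸ 1) × (b ≡ i)
Edge D a b = ⊥

Step : {n : ℕ} → Factor n → ℕ → ℕ → Set
Step F a b = (a ≡ b) ⊎ Edge F a b

-- t-th factor (0-based) of a sequence; default outside range is irrelevant
at : {n : ℕ} → List (Factor n) → ℕ → Factor n
at [] _ = D
at (f ∷ fs) zero = f
at (f ∷ fs) (suc t) = at fs t

pow : {n : ℕ} → ℕ → List (Factor n) → List (Factor n)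
pow zero fs = []
pow (suc w) fs = fs ++ pow w fs

-- v : layer ↦ vertex label is a path in the network of gs from source s to sink e
IsPath : {n : ℕ} → List (Factor n) → ℕ → ℕ → (ℕ → ℕ) → Set
IsPath {n} gs s e v =
  (v 0 ≡ s) × (v (length gs) ≡ e)
  × (∀ t → t ≤ length gs → (1 ≤ v t) × (v t ≤ n))
  × (∀ t → t < length gs → Step (at gs t) (v t) (v (suc t)))

-- The network of A^w contains pairwise vertex-disjoint paths, one from source
-- x to sink x-n+c for every x ∈ α = {n-c+1,…,n}.  Path number k (0 ≤ k < c)
-- goes from source n-c+1+k to sink 1+k.
Admits : (n : ℕ) → List (Factor n) → (c w : ℕ) → Set
Admits n fs c w = Σ (ℕ → ℕ → ℕ) λ π →
  (∀ k → k < c → IsPath (pow w fs) (n ∸ c + suc k) (suc k) (π k))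
  × (∀ k k' → k < c → k' < c → k ≢ k' →
       ∀ t → t ≤ length (pow w fs) → π k t ≢ π k' t)

-- w(A,c) = x, where x = just w means the least positive integer w with
-- Admits, and x = nothing means +∞ (no positive w admits such a family).
WIs : (n : ℕ) → List (Factor n) → ℕ → Maybe ℕ → Set
WIs n fs c (just w) = (1 ≤ w) × Admits n fs c w × (∀ v → 1 ≤ v → v < w → ¬ Admits n fs c v)
WIs n fs c nothing = ∀ v → 1 ≤ v → ¬ Admits n fs c v

replaceU : {n : ℕ} → Factor n → Factor n
replaceU (L i p q) = L i p q
replaceU (U i p q) = D
replaceU D = D

-- Disjoint paths in a planar network never cross, so the c paths are strictly
-- ordered at every layer.  Replacing each path by its running minimum keeps
-- them strictly ordered (hence disjoint); a running minimum only moves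
-- horizontally or down along an L-edge, so it is a path of the network in which
-- every U-factor has become diagonal, and it still ends at its sink because the
-- k-th path never drops below its sink k+1.  Conversely every path of that
-- network is a path of the original one.
module Submission where

open import Defs
open import Data.Nat using (ℕ; _≤_; _∸_)
open import Data.List using (List; map)
open import Data.Maybe using (Maybe)
open import Function.Bundles using (_⇔_)

open import Data.Nat using (zero; suc; _+_; _<_; _⊓_; z≤n; s≤s; _≤?_)
open import Data.Nat.Properties
open import Data.List using (_∷_; _++_; length)
open import Data.List.Properties using (map-++; length-map)
open import Data.Product using (_×_; _,_; Σ; proj₁; proj₂)
open import Data.Sum using (inj₁; inj₂)
open import Data.Maybe using (just; nothing)
open import Data.Empty using (⊥-elim)
open import Relation.Binary.PropositionalEquality
open import Relation.Binary.Definitions using (tri<; tri≈; tri>)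
open import Relation.Nullary using (yes; no)
open import Function.Base using (_∘_)
open import Function.Bundles using (mk⇔; Equivalence)

DisjointPaths : (n : ℕ) → List (Factor n) → ℕ → Set
DisjointPaths n gs c = Σ (ℕ → ℕ → ℕ) λ π →
  (∀ k → k < c → IsPath gs (n ∸ c + suc k) (suc k) (π k))
  × (∀ k k' → k < c → k' < c → k ≢ k' →
       ∀ t → t ≤ length gs → π k t ≢ π k' t)

at-map : ∀ {n} (f : Factor n → Factor n) gs {t} → t < length gs → at (map f gs) t ≡ f (at gs t)
at-map f (g ∷ gs) {zero} _ = refl
at-map f (g ∷ gs) {suc t} (s≤s t<) = at-map f gs t<

pow-map : ∀ {n} (f : Factor n → Factor n) w fs → pow w (map f fs) ≡ map f (pow w fs)
pow-map f zero fs = refl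
pow-map f (suc w) fs = begin
  map f fs ++ pow w (map f fs)  ≡⟨ cong (map f fs ++_) (pow-map f w fs) ⟩
  map f fs ++ map f (pow w fs)  ≡⟨ map-++ f fs (pow w fs) ⟨
  map f (fs ++ pow w fs)        ∎
  where open ≡-Reasoning

module _ {n : ℕ} (f : Factor n → Factor n) {gs : List (Factor n)} where

  private
    length≡ : length (map f gs) ≡ length gs
    length≡ = length-map f gs

  mkIsPath-map : ∀ {s e v} → v 0 ≡ s → v (length gs) ≡ e →
                 (∀ t → t ≤ length gs → (1 ≤ v t) × (v t ≤ n)) →
                 (∀ t → t < length gs → Step (f (at gs t)) (v t) (v (suc t))) →
                 IsPath (map f gs) s e v
  mkIsPath-map {e = e} {v} v₀ v-end bounded step =
    v₀ , subst (λ m → v m ≡ e) (sym length≡) v-end ,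
    (λ t t≤ → bounded t (subst (t ≤_) length≡ t≤)) ,
    λ t t< → let t<′ = subst (t <_) length≡ t< in
      subst (λ F → Step F (v t) (v (suc t))) (sym (at-map f gs t<′)) (step t t<′)

  module _ (f-removesEdges : ∀ F {a b} → Step (f F) a b → Step F a b) where

    IsPath-map⁻ : ∀ {s e v} → IsPath (map f gs) s e v → IsPath gs s e v
    IsPath-map⁻ {e = e} {v} (v₀ , v-end , bounded , step) =
      v₀ , subst (λ m → v m ≡ e) length≡ v-end ,
      (λ t t≤ → bounded t (subst (t ≤_) (sym length≡) t≤)) ,
      λ t t< → f-removesEdges (at gs t)
        (subst (λ F → Step F (v t) (v (suc t))) (at-map f gs t<)
          (step t (subst (t <_) (sym length≡) t<)))

    DisjointPaths-map⁻ : ∀ {c} → DisjointPaths n (map f gs) c → DisjointPaths n gs c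
    DisjointPaths-map⁻ (π , paths , disjoint) =
      π , (λ k k<c → IsPath-map⁻ (paths k k<c)) ,
      λ k k' k<c k'<c k≢k' t t≤ → disjoint k k' k<c k'<c k≢k' t (subst (t ≤_) (sym length≡) t≤)

IsPath-steps : ∀ {n} (gs : List (Factor n)) {s e v} → IsPath gs s e v →
               ∀ t → t < length gs → Step (at gs t) (v t) (v (suc t))
IsPath-steps _ (_ , _ , _ , steps) = steps

replaceU-removesEdges : ∀ {n} (F : Factor n) {a b} → Step (replaceU F) a b → Step F a b
replaceU-removesEdges (L i p q) s = s
replaceU-removesEdges (U i p q) (inj₁ a≡b) = inj₁ a≡b
replaceU-removesEdges D s = s

Step-noncrossing : ∀ {n} (F : Factor n) {a a' b b'} → a < a' → b ≢ b' →
                   Step F a b → Step F a' b' → b < b'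
Step-noncrossing F a<a' _ (inj₁ refl) (inj₁ refl) = a<a'
Step-noncrossing (L (suc (suc j)) (s≤s (s≤s z≤n)) _) a<a' b≢b' (inj₁ refl) (inj₂ (refl , refl)) =
  ≤∧≢⇒< (≤-pred a<a') b≢b'
Step-noncrossing (L (suc (suc j)) (s≤s (s≤s z≤n)) _) a<a' _ (inj₂ (refl , refl)) (inj₁ refl) =
  <-trans (n<1+n (suc j)) a<a'
Step-noncrossing (L (suc (suc j)) (s≤s (s≤s z≤n)) _) a<a' _ (inj₂ (refl , refl)) (inj₂ (refl , refl)) =
  ⊥-elim (<-irrefl refl a<a')
Step-noncrossing (U (suc (suc j)) (s≤s (s≤s z≤n)) _) a<a' _ (inj₁ refl) (inj₂ (refl , refl)) =
  m<n⇒m<1+n a<a'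
Step-noncrossing (U (suc (suc j)) (s≤s (s≤s z≤n)) _) a<a' b≢b' (inj₂ (refl , refl)) (inj₁ refl) =
  ≤∧≢⇒< a<a' b≢b'
Step-noncrossing (U (suc (suc j)) (s≤s (s≤s z≤n)) _) a<a' _ (inj₂ (refl , refl)) (inj₂ (refl , refl)) =
  ⊥-elim (<-irrefl refl a<a')

replaceU-Step-⊓ : ∀ {n} (F : Factor n) {r a b} → r ≤ a → Step F a b → Step (replaceU F) r (r ⊓ b)
replaceU-Step-⊓ F r≤a (inj₁ refl) = inj₁ (sym (m≤n⇒m⊓n≡m r≤a))
replaceU-Step-⊓ (L (suc (suc j)) (s≤s (s≤s z≤n)) _) {r} r≤a (inj₂ (refl , refl)) with r ≤? suc j
... | yes r≤b = inj₁ (sym (m≤n⇒m⊓n≡m r≤b))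
... | no r≰b with ≤-antisym r≤a (≰⇒> r≰b)
...   | refl = inj₂ (refl , m≥n⇒m⊓n≡n (n≤1+n (suc j)))
replaceU-Step-⊓ (U (suc (suc j)) (s≤s (s≤s z≤n)) _) r≤a (inj₂ (refl , refl)) =
  inj₁ (sym (m≤n⇒m⊓n≡m (m≤n⇒m≤1+n r≤a)))

runningMin : (ℕ → ℕ) → ℕ → ℕ
runningMin v zero    = v zero
runningMin v (suc t) = runningMin v t ⊓ v (suc t)

runningMin-≤ : ∀ v t → runningMin v t ≤ v t
runningMin-≤ v zero    = ≤-refl
runningMin-≤ v (suc t) = m⊓n≤n (runningMin v t) (v (suc t))

runningMin-glb : ∀ v {m} t → (∀ s → s ≤ t → m ≤ v s) → m ≤ runningMin v t
runningMin-glb v zero    m≤v = m≤v 0 z≤n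
runningMin-glb v (suc t) m≤v =
  ⊓-glb (runningMin-glb v t (λ s s≤t → m≤v s (m≤n⇒m≤1+n s≤t))) (m≤v (suc t) ≤-refl)

runningMin-mono-< : ∀ u v t → (∀ s → s ≤ t → u s < v s) → runningMin u t < runningMin v t
runningMin-mono-< u v zero    u<v = u<v 0 z≤n
runningMin-mono-< u v (suc t) u<v =
  ⊓-mono-≤ (runningMin-mono-< u v t (λ s s≤t → u<v s (m≤n⇒m≤1+n s≤t))) (u<v (suc t) ≤-refl)

module _ {n c : ℕ} {gs : List (Factor n)} {π : ℕ → ℕ → ℕ}
         (paths : ∀ k → k < c → IsPath gs (n ∸ c + suc k) (suc k) (π k))
         (disjoint : ∀ k k' → k < c → k' < c → k ≢ k' → ∀ t → t ≤ length gs → π k t ≢ π k' t)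
         where

  paths-ordered : ∀ {k k'} → k < k' → k' < c → ∀ t → t ≤ length gs → π k t < π k' t
  paths-ordered {k} {k'} k<k' k'<c zero _ =
    subst₂ _<_ (sym (proj₁ (paths k k<c))) (sym (proj₁ (paths k' k'<c))) (+-monoʳ-< (n ∸ c) (s≤s k<k'))
    where k<c = <-trans k<k' k'<c
  paths-ordered {k} {k'} k<k' k'<c (suc t) t<len =
    Step-noncrossing (at gs t) (paths-ordered k<k' k'<c t (<⇒≤ t<len))
      (disjoint k k' k<c k'<c (<⇒≢ k<k') (suc t) t<len)
      (IsPath-steps gs (paths k k<c) t t<len) (IsPath-steps gs (paths k' k'<c) t t<len)
    where k<c = <-trans k<k' k'<c

  paths-above-sinks : ∀ {k} → k < c → ∀ t → t ≤ length gs → suc k ≤ π k t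
  paths-above-sinks {zero}  0<c t t≤len with paths zero 0<c
  ... | _ , _ , bounded , _ = proj₁ (bounded t t≤len)
  paths-above-sinks {suc k} k<c t t≤len =
    ≤-trans (s≤s (paths-above-sinks (<-trans (n<1+n k) k<c) t t≤len)) (paths-ordered (n<1+n k) k<c t t≤len)

  runningMin-IsPath : ∀ {k} → k < c → IsPath (map replaceU gs) (n ∸ c + suc k) (suc k) (runningMin (π k))
  runningMin-IsPath {k} k<c with paths k k<c
  ... | v₀ , v-end , bounded , steps = mkIsPath-map replaceU {gs}
    v₀
    (≤-antisym (≤-trans (runningMin-≤ (π k) (length gs)) (≤-reflexive v-end))
               (runningMin-glb (π k) (length gs) (paths-above-sinks k<c)))
    (λ t t≤len → runningMin-glb (π k) t (λ s s≤t → proj₁ (bounded s (≤-trans s≤t t≤len)))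
               , ≤-trans (runningMin-≤ (π k) t) (proj₂ (bounded t t≤len)))
    (λ t t<len → replaceU-Step-⊓ (at gs t) (runningMin-≤ (π k) t) (steps t t<len))

  runningMin-ordered : ∀ {k k'} → k < k' → k' < c → ∀ t → t ≤ length gs →
                       runningMin (π k) t < runningMin (π k') t
  runningMin-ordered k<k' k'<c t t≤len =
    runningMin-mono-< _ _ t (λ s s≤t → paths-ordered k<k' k'<c s (≤-trans s≤t t≤len))

  runningMin-disjoint : ∀ k k' → k < c → k' < c → k ≢ k' →
                        ∀ t → t ≤ length (map replaceU gs) → runningMin (π k) t ≢ runningMin (π k') t
  runningMin-disjoint k k' k<c k'<c k≢k' t t≤len′ with <-cmp k k'
  ... | tri< k<k' _ _ = <⇒≢ (runningMin-ordered k<k' k'<c t t≤len)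
    where t≤len = subst (t ≤_) (length-map replaceU gs) t≤len′
  ... | tri≈ _ k≡k' _ = ⊥-elim (k≢k' k≡k')
  ... | tri> _ _ k'<k = ≢-sym (<⇒≢ (runningMin-ordered k'<k k<c t t≤len))
    where t≤len = subst (t ≤_) (length-map replaceU gs) t≤len′

  DisjointPaths-replaceU : DisjointPaths n (map replaceU gs) c
  DisjointPaths-replaceU = (λ k → runningMin (π k)) , (λ k → runningMin-IsPath) , runningMin-disjoint

Admits-replaceU : ∀ n (fs : List (Factor n)) c w → Admits n fs c w ⇔ Admits n (map replaceU fs) c w
Admits-replaceU n fs c w = mk⇔
  (λ (_ , paths , disjoint) → subst (λ gs → DisjointPaths n gs c) (sym (pow-map replaceU w fs))
                                (DisjointPaths-replaceU {gs = pow w fs} paths disjoint))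
  (λ admits → DisjointPaths-map⁻ replaceU {pow w fs} replaceU-removesEdges
                (subst (λ gs → DisjointPaths n gs c) (pow-map replaceU w fs) admits))

WIs-cong : ∀ {n} {fs gs : List (Factor n)} {c} → (∀ w → Admits n fs c w ⇔ Admits n gs c w) →
           ∀ x → WIs n fs c x ⇔ WIs n gs c x
WIs-cong fs⇔gs (just w) = mk⇔
  (λ (1≤w , admits , minimal) → 1≤w , to (fs⇔gs w) admits , λ v 1≤v v<w → minimal v 1≤v v<w ∘ from (fs⇔gs v))
  (λ (1≤w , admits , minimal) → 1≤w , from (fs⇔gs w) admits , λ v 1≤v v<w → minimal v 1≤v v<w ∘ to (fs⇔gs v))
  where open Equivalence
WIs-cong fs⇔gs nothing = mk⇔
  (λ never v 1≤v → never v 1≤v ∘ from (fs⇔gs v))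
  (λ never v 1≤v → never v 1≤v ∘ to (fs⇔gs v))
  where open Equivalence

proposition8 : (n : ℕ) → 2 ≤ n → (fs : List (Factor n)) → (c : ℕ) → 1 ≤ c → c ≤ n ∸ 1 →
    (x : Maybe ℕ) → WIs n fs c x ⇔ WIs n (map replaceU fs) c x
proposition8 n _ fs c _ _ = WIs-cong (Admits-replaceU n fs c)
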